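{- Let $r\ge 1$ be an integer and $A$ a non-empty set of non-negative integers, both fixed. Choose integers $q$ and $i$ with $1\le q\le r$ and $0\le i\le r-q$ such that $f(q,i,A)^{1/q}$ is as large as possible, and suppose the maximum is attained at $q=p$ (with the corresponding $i$). Then, as $n\to\infty$, $g^{(r)}_A(n)=\Theta\big(f(p,i,A)^{n/p}\big)$.
   Context: An $r$-uniform hypergraph is a finite vertex set with a family of $r$-element subsets (hyperedges). A vertex is isolated if it lies in no hyperedge. A set $S$ of vertices is an $A$-transversal of an $r$-uniform hypergraph $\mathcal{H}$ if $|H\cap S|\in A$ for every hyperedge $H$. For $n\ge r$, $g^{(r)}_A(n)$ denotes the maximum number of $A$-transversals in an $r$-uniform hypergraph on $n$ vertices with no isolated vertices. For an integer $i\ge 0$, $A(i)=\{a-i: a\in A\}\cap\{0,1,2,\dots\}$, and $f(q,i,A)=\sum_{b\in A(i)}\binom{q}{b}$. The constants in $\Theta$ may depend on $r$ and $A$ but not on $n$. -}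

module Defs where

open import Data.Bool using (Bool; true; false; _∧_; if_then_else_)
open import Data.Nat using (ℕ; zero; suc; _+_; _*_; _⊔_; _≡ᵇ_)
open import Data.Nat.Combinatorics using (_C_)
open import Data.List using (List; []; _∷_; _++_; map; filterᵇ; length; foldr)
open import Data.Bool.ListAction using (all; and)
open import Data.Vec using (Vec; []; _∷_; toList)
open import Data.Fin.Subset using (Subset; _∩_; _∪_; ∣_∣; ⊥)

allSubsets : (n : ℕ) → List (Subset n)
allSubsets zero    = [] ∷ []
allSubsets (suc n) = map (true ∷_) (allSubsets n) ++ map (false ∷_) (allSubsets n)

sublists : {X : Set} → List X → List (List X)
sublists []       = [] ∷ []
sublists (x ∷ xs) = map (x ∷_) (sublists xs) ++ sublists xs

rSubsets : (r n : ℕ) → List (Subset n)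
rSubsets r n = filterᵇ (λ S → ∣ S ∣ ≡ᵇ r) (allSubsets n)

-- An r-uniform hypergraph on vertex set Fin n is a family (set) of r-subsets;
-- we enumerate them as sublists of rSubsets r n (distinct hyperedges).
noIsolated : {n : ℕ} → List (Subset n) → Bool
noIsolated {n} E = and (toList (foldr _∪_ ⊥ E))

isATransversal : {n : ℕ} → (ℕ → Bool) → List (Subset n) → Subset n → Bool
isATransversal A E S = all (λ H → A ∣ H ∩ S ∣) E

numTransversals : {n : ℕ} → (ℕ → Bool) → List (Subset n) → ℕ
numTransversals {n} A E = length (filterᵇ (isATransversal A E) (allSubsets n))

-- g^{(r)}_A(n): maximum number of A-transversals over r-uniform hypergraphs
-- on n vertices with no isolated vertices (0 if there is no such hypergraph).
g : (r : ℕ) → (ℕ → Bool) → ℕ → ℕ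
g r A n = foldr _⊔_ 0 (map (numTransversals A)
            (filterᵇ noIsolated (sublists (rSubsets r n))))

-- membership in A(i) = {a - i : a ∈ A} ∩ ℕ : b ∈ A(i) iff b + i ∈ A
Ashift : (ℕ → Bool) → ℕ → ℕ → Bool
Ashift A i b = A (b + i)

sumUpTo : (ℕ → Bool) → (ℕ → ℕ) → ℕ → ℕ
sumUpTo P h zero    = if P zero then h zero else 0
sumUpTo P h (suc m) = sumUpTo P h m + (if P (suc m) then h (suc m) else 0)

-- f(q,i,A) = Σ_{b ∈ A(i)} C(q,b); terms with b > q vanish, so we sum over b ≤ q.
f : ℕ → ℕ → (ℕ → Bool) → ℕ
f q i A = sumUpTo (Ashift A i) (λ b → q C b) q

{-# OPTIONS --safe #-}
module Submission where

-- Write F = f(p,i,A) and #E for the number of A-transversals of a hypergraph E.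
--
-- Upper bound: add the edges one at a time. If the edge H brings q new vertices M = H ∖ ⋃E, then
-- summing out the coordinates of a candidate set inside M gives
-- 2^q · #(H ∷ E) = Σ_S [S is a transversal of E] · f(q, ∣H ∩ ⋃E ∩ S∣, A) ≤ G · #E,
-- where G = max_{j ≤ r−q} f(q,j,A) and G^p ≤ F^q by maximality. Once all n vertices are covered
-- this telescopes to #E^p ≤ F^n.
--
-- Lower bound: take a core of c = r − p vertices and m pages of p vertices, each page together with
-- the core forming an edge. Transversals meeting the core in exactly i vertices number
-- (c C i) · F^m, every page contributing a factor F independently. The ℓ < p leftover vertices
-- are covered by one more edge (leftovers, core and the last page minus ℓ vertices), and every
-- such transversal extends to the leftovers in at least one way. So g(n) ≥ F^m for
-- n = c + m·p + ℓ with m ≥ 1, that is F^n ≤ F^r · g(n)^p.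

open import Data.Bool using (Bool; true; false; _∧_; _∨_; if_then_else_; T)
import Data.Bool.Properties as Bool
open import Data.Bool.ListAction using (and; all)
open import Data.Nat
  using (ℕ; zero; suc; _+_; _*_; _^_; _≤_; _<_; _∸_; _⊔_; _≡ᵇ_; z≤n; s≤s; s≤s⁻¹; z<s; NonZero; >-nonZero; >-nonZero⁻¹)
open import Data.Nat.DivMod using (_/_; _%_; m≡m%n+[m/n]*n; m%n<n; m≥n⇒m/n>0)
open import Data.Nat.Properties
open import Algebra.Properties.CommutativeSemigroup +-commutativeSemigroup
  using () renaming (interchange to +-interchange)
open import Data.Nat.Combinatorics using (_C_; nCk+nC[k+1]≡[n+1]C[k+1]; k>n⇒nCk≡0)
open import Data.Nat.Tactic.RingSolver using (solve-∀)
open import Data.List using (List; []; _∷_; map; filter; filterᵇ; length; foldr)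
open import Data.List.Properties using (length-++; filter-++; foldr-preservesᵇ)
open import Data.List.Relation.Unary.All using (All; []; _∷_)
import Data.List.Relation.Unary.All as All
open import Data.List.Relation.Unary.All.Properties using (map⁺; all-anti-mono)
open import Data.List.Relation.Unary.Any using (here; there)
open import Data.List.Membership.Propositional using (_∈_)
open import Data.List.Membership.Propositional.Properties
  using (∈-map⁺; ∈-map⁻; ∈-++⁺ˡ; ∈-++⁺ʳ; ∈-++⁻; ∈-filter⁺; ∈-filter⁻)
open import Data.Vec using ([]; _∷_; _++_; replicate; toList; splitAt)
open import Data.Vec.Properties using (≡-dec; zipWith-++)
import Data.List.Membership.DecPropositional as DecMembership
open import Data.Fin.Subset using (Subset; _⊆_; _∩_; _∪_; _─_; ∁; ∣_∣; ⊥; ⊤; ⋃)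
open import Data.Fin.Subset.Properties
  using (∩-identityˡ; ∩-identityʳ; ∩-zeroˡ; ∪-identityʳ; ∪-zeroʳ; ∣∁p∣≡n∸∣p∣; ∣p∩q∣≤∣p∣; ∣⊥∣≡0; ∣⊤∣≡n;
         ⊆-trans; ⊆-antisym; ⊆⊤; ⊥⊆; p⊆p∪q; q⊆p∪q; x∈p∪q⁻)
open import Data.Product using (Σ; _×_; ∃; ∃₂; _,_; proj₁; proj₂)
open import Data.Sum using (inj₁; inj₂; [_,_]′)
open import Relation.Nullary using (Dec; does)
open import Relation.Nullary.Decidable using (T?)
open import Data.Unit using (tt)
open import Data.Empty using (⊥-elim)
open import Function using (_∘_)
open import Relation.Binary.PropositionalEquality
open import Defs

private
  variable
    m n : ℕ

𝟙 : Bool → ℕ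
𝟙 b = if b then 1 else 0

𝟙-∧ : ∀ a b → 𝟙 (a ∧ b) ≡ 𝟙 a * 𝟙 b
𝟙-∧ true  b = sym (+-identityʳ (𝟙 b))
𝟙-∧ false b = refl

𝟙-mono : ∀ {a b} → (T a → T b) → 𝟙 a ≤ 𝟙 b
𝟙-mono {false}         _ = z≤n
𝟙-mono {true}  {true}  _ = ≤-refl
𝟙-mono {true}  {false} h = ⊥-elim (h tt)

T⇒𝟙≡1 : ∀ {b} → T b → 𝟙 b ≡ 1
T⇒𝟙≡1 {true} _ = refl

𝟙>0⇒T : ∀ {b} → 0 < 𝟙 b → T b
𝟙>0⇒T {true} _ = tt

T-∧ˡ : ∀ a {b} → T (a ∧ b) → T a
T-∧ˡ true _ = tt

T-∧ʳ : ∀ a {b} → T (a ∧ b) → T b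
T-∧ʳ true h = h

∧-≡ᵇ-subst : ∀ (P : ℕ → Bool) c i b → (c ≡ᵇ i) ∧ (P c ∧ b) ≡ P i ∧ ((c ≡ᵇ i) ∧ b)
∧-≡ᵇ-subst P c i b with c ≡ᵇ i in eq
... | true  = cong (λ x → P x ∧ b) (≡ᵇ⇒≡ c i (subst T (sym eq) tt))
... | false = sym (Bool.∧-zeroʳ (P i))

-- binomialSum q h = Σ_b (q C b) * h b, written through Pascal's rule.
binomialSum : ℕ → (ℕ → ℕ) → ℕ
binomialSum zero    h = h 0
binomialSum (suc q) h = binomialSum q h + binomialSum q (h ∘ suc)

binomialSum-cong : ∀ q {h h′} → (∀ b → h b ≡ h′ b) → binomialSum q h ≡ binomialSum q h′
binomialSum-cong zero    h≡h′ = h≡h′ 0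
binomialSum-cong (suc q) h≡h′ =
  cong₂ _+_ (binomialSum-cong q h≡h′) (binomialSum-cong q (h≡h′ ∘ suc))

binomialSum-*ʳ : ∀ q h k → binomialSum q (λ b → h b * k) ≡ binomialSum q h * k
binomialSum-*ʳ zero    h k = refl
binomialSum-*ʳ (suc q) h k = begin
  binomialSum q (λ b → h b * k) + binomialSum q (λ b → h (suc b) * k)
    ≡⟨ cong₂ _+_ (binomialSum-*ʳ q h k) (binomialSum-*ʳ q (h ∘ suc) k) ⟩
  binomialSum q h * k + binomialSum q (h ∘ suc) * k
    ≡⟨ *-distribʳ-+ k (binomialSum q h) _ ⟨
  binomialSum (suc q) h * k ∎
  where open ≡-Reasoning

≤-binomialSum : ∀ q h {b} → b ≤ q → h b ≤ binomialSum q h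
≤-binomialSum zero    h z≤n = ≤-refl
≤-binomialSum (suc q) h {zero}  _ = ≤-trans (≤-binomialSum q h z≤n) (m≤m+n _ _)
≤-binomialSum (suc q) h {suc b} (s≤s b≤q) =
  ≤-trans (≤-binomialSum q (h ∘ suc) b≤q) (m≤n+m _ _)

sumUpTo-cong : ∀ P {h h′} m → (∀ b → h b ≡ h′ b) → sumUpTo P h m ≡ sumUpTo P h′ m
sumUpTo-cong P zero    h≡h′ = cong (if P 0 then_else 0) (h≡h′ 0)
sumUpTo-cong P (suc m) h≡h′ =
  cong₂ _+_ (sumUpTo-cong P m h≡h′) (cong (if P (suc m) then_else 0) (h≡h′ (suc m)))

if-+ : ∀ c x y → (if c then x + y else 0) ≡ (if c then x else 0) + (if c then y else 0)
if-+ true  x y = refl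
if-+ false x y = refl

sumUpTo-+ : ∀ P h h′ m → sumUpTo P (λ b → h b + h′ b) m ≡ sumUpTo P h m + sumUpTo P h′ m
sumUpTo-+ P h h′ zero    = if-+ (P 0) (h 0) (h′ 0)
sumUpTo-+ P h h′ (suc m) =
  trans (cong₂ _+_ (sumUpTo-+ P h h′ m) (if-+ (P (suc m)) (h (suc m)) (h′ (suc m))))
        (+-interchange (sumUpTo P h m) _ _ _)

sumUpTo-peel : ∀ P h m →
  sumUpTo P h (suc m) ≡ (if P 0 then h 0 else 0) + sumUpTo (P ∘ suc) (h ∘ suc) m
sumUpTo-peel P h zero    = refl
sumUpTo-peel P h (suc m) =
  trans (cong (_+ (if P (suc (suc m)) then h (suc (suc m)) else 0)) (sumUpTo-peel P h m))
        (+-assoc (if P 0 then h 0 else 0) _ _)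

sumUpTo-C-extend : ∀ P q → sumUpTo P (q C_) (suc q) ≡ sumUpTo P (q C_) q
sumUpTo-C-extend P q with P (suc q)
... | true  = trans (cong (sumUpTo P (q C_) q +_) (k>n⇒nCk≡0 (n<1+n q))) (+-identityʳ _)
... | false = +-identityʳ _

sumUpTo-binomial : ∀ q P → sumUpTo P (q C_) q ≡ binomialSum q (𝟙 ∘ P)
sumUpTo-binomial zero    P = refl
sumUpTo-binomial (suc q) P = begin
  sumUpTo P (suc q C_) (suc q)
    ≡⟨ sumUpTo-peel P (suc q C_) q ⟩
  𝟙 (P 0) + sumUpTo (P ∘ suc) (λ b → suc q C suc b) q
    ≡⟨ cong (𝟙 (P 0) +_) (sumUpTo-cong (P ∘ suc) q (λ b → sym (nCk+nC[k+1]≡[n+1]C[k+1] q b))) ⟩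
  𝟙 (P 0) + sumUpTo (P ∘ suc) (λ b → q C b + q C suc b) q
    ≡⟨ cong (𝟙 (P 0) +_) (sumUpTo-+ (P ∘ suc) (q C_) (λ b → q C suc b) q) ⟩
  𝟙 (P 0) + (sumUpTo (P ∘ suc) (q C_) q + sumUpTo (P ∘ suc) (λ b → q C suc b) q)
    ≡⟨ rearrange (𝟙 (P 0)) _ _ ⟩
  (𝟙 (P 0) + sumUpTo (P ∘ suc) (λ b → q C suc b) q) + sumUpTo (P ∘ suc) (q C_) q
    ≡⟨ cong (_+ sumUpTo (P ∘ suc) (q C_) q) (sumUpTo-peel P (q C_) q) ⟨
  sumUpTo P (q C_) (suc q) + sumUpTo (P ∘ suc) (q C_) q
    ≡⟨ cong₂ _+_ (sumUpTo-C-extend P q) refl ⟩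
  sumUpTo P (q C_) q + sumUpTo (P ∘ suc) (q C_) q
    ≡⟨ cong₂ _+_ (sumUpTo-binomial q P) (sumUpTo-binomial q (P ∘ suc)) ⟩
  binomialSum (suc q) (𝟙 ∘ P) ∎
  where
  open ≡-Reasoning
  rearrange : ∀ a b c → a + (b + c) ≡ (a + c) + b
  rearrange = solve-∀

f≡binomialSum : ∀ q c A → f q c A ≡ binomialSum q (λ b → 𝟙 (A (b + c)))
f≡binomialSum q c A = sumUpTo-binomial q (Ashift A c)

sumSubsets : (n : ℕ) → (Subset n → ℕ) → ℕ
sumSubsets zero    w = w []
sumSubsets (suc n) w = sumSubsets n (w ∘ (true ∷_)) + sumSubsets n (w ∘ (false ∷_))

sumSubsets-cong : ∀ n {w w′ : Subset n → ℕ} → (∀ S → w S ≡ w′ S) →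
  sumSubsets n w ≡ sumSubsets n w′
sumSubsets-cong zero    w≡w′ = w≡w′ []
sumSubsets-cong (suc n) w≡w′ =
  cong₂ _+_ (sumSubsets-cong n (w≡w′ ∘ (true ∷_))) (sumSubsets-cong n (w≡w′ ∘ (false ∷_)))

sumSubsets-mono-≤ : ∀ n {w w′ : Subset n → ℕ} → (∀ S → w S ≤ w′ S) →
  sumSubsets n w ≤ sumSubsets n w′
sumSubsets-mono-≤ zero    w≤w′ = w≤w′ []
sumSubsets-mono-≤ (suc n) w≤w′ =
  +-mono-≤ (sumSubsets-mono-≤ n (w≤w′ ∘ (true ∷_))) (sumSubsets-mono-≤ n (w≤w′ ∘ (false ∷_)))

sumSubsets-+ : ∀ n (w w′ : Subset n → ℕ) →
  sumSubsets n (λ S → w S + w′ S) ≡ sumSubsets n w + sumSubsets n w′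
sumSubsets-+ zero    w w′ = refl
sumSubsets-+ (suc n) w w′ =
  trans (cong₂ _+_ (sumSubsets-+ n (w ∘ (true ∷_)) (w′ ∘ (true ∷_)))
                   (sumSubsets-+ n (w ∘ (false ∷_)) (w′ ∘ (false ∷_))))
        (+-interchange (sumSubsets n (w ∘ (true ∷_))) _ _ _)

sumSubsets-*ˡ : ∀ n k (w : Subset n → ℕ) → sumSubsets n (λ S → k * w S) ≡ k * sumSubsets n w
sumSubsets-*ˡ zero    k w = refl
sumSubsets-*ˡ (suc n) k w =
  trans (cong₂ _+_ (sumSubsets-*ˡ n k (w ∘ (true ∷_))) (sumSubsets-*ˡ n k (w ∘ (false ∷_))))
        (sym (*-distribˡ-+ k (sumSubsets n (w ∘ (true ∷_))) _))

sumSubsets-*ʳ : ∀ n k (w : Subset n → ℕ) → sumSubsets n (λ S → w S * k) ≡ sumSubsets n w * k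
sumSubsets-*ʳ zero    k w = refl
sumSubsets-*ʳ (suc n) k w =
  trans (cong₂ _+_ (sumSubsets-*ʳ n k (w ∘ (true ∷_))) (sumSubsets-*ʳ n k (w ∘ (false ∷_))))
        (sym (*-distribʳ-+ k (sumSubsets n (w ∘ (true ∷_))) _))

sumSubsets-1 : ∀ n → sumSubsets n (λ _ → 1) ≡ 2 ^ n
sumSubsets-1 zero    = refl
sumSubsets-1 (suc n) =
  trans (cong₂ _+_ (sumSubsets-1 n) (sumSubsets-1 n)) (cong (2 ^ n +_) (sym (+-identityʳ (2 ^ n))))

sumSubsets-++ : ∀ m n (w : Subset (m + n) → ℕ) →
  sumSubsets (m + n) w ≡ sumSubsets n (λ S → sumSubsets m (λ s → w (s ++ S)))
sumSubsets-++ zero    n w = refl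
sumSubsets-++ (suc m) n w =
  trans (cong₂ _+_ (sumSubsets-++ m n (w ∘ (true ∷_))) (sumSubsets-++ m n (w ∘ (false ∷_))))
        (sym (sumSubsets-+ n (λ S → sumSubsets m (λ s → w (true ∷ s ++ S)))
                             (λ S → sumSubsets m (λ s → w (false ∷ s ++ S)))))

sumSubsets-∣∣ : ∀ n h → sumSubsets n (λ s → h ∣ s ∣) ≡ binomialSum n h
sumSubsets-∣∣ zero    h = refl
sumSubsets-∣∣ (suc n) h =
  trans (cong₂ _+_ (sumSubsets-∣∣ n (h ∘ suc)) (sumSubsets-∣∣ n h))
        (+-comm (binomialSum n (h ∘ suc)) (binomialSum n h))

sumSubsets-𝟙≡f : ∀ q c A → sumSubsets q (λ s → 𝟙 (A (∣ s ∣ + c))) ≡ f q c A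
sumSubsets-𝟙≡f q c A = trans (sumSubsets-∣∣ q (λ b → 𝟙 (A (b + c)))) (sym (f≡binomialSum q c A))

-- Summing out the coordinates inside a set

Disjoint : Subset n → Subset n → Set
Disjoint p q = ∣ p ∩ q ∣ ≡ 0

Ignores : {B : Set} → Subset n → (Subset n → B) → Set
Ignores M w = ∀ S S′ → S ─ M ≡ S′ ─ M → w S ≡ w S′

Ignores-∷ : ∀ {B : Set} x b {M : Subset n} {w : Subset (suc n) → B} →
  Ignores (b ∷ M) w → Ignores M (w ∘ (x ∷_))
Ignores-∷ x false ign S S′ eq = ign (x ∷ S) (x ∷ S′) (cong (x ∷_) eq)
Ignores-∷ x true  ign S S′ eq = ign (x ∷ S) (x ∷ S′) (cong (false ∷_) eq)

∣∩∣≡∣∩─∣ : ∀ (D M S : Subset n) → Disjoint D M → ∣ D ∩ S ∣ ≡ ∣ D ∩ (S ─ M) ∣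
∣∩∣≡∣∩─∣ []          []          []          _ = refl
∣∩∣≡∣∩─∣ (false ∷ D) (_     ∷ M) (_     ∷ S) d = ∣∩∣≡∣∩─∣ D M S d
∣∩∣≡∣∩─∣ (true  ∷ D) (false ∷ M) (true  ∷ S) d = cong suc (∣∩∣≡∣∩─∣ D M S d)
∣∩∣≡∣∩─∣ (true  ∷ D) (false ∷ M) (false ∷ S) d = ∣∩∣≡∣∩─∣ D M S d
∣∩∣≡∣∩─∣ (true  ∷ D) (true  ∷ M) _           ()

Ignores-∣∩∣ : ∀ (D : Subset n) {M} → Disjoint D M → Ignores M (λ S → ∣ D ∩ S ∣)
Ignores-∣∩∣ D {M} d S S′ eq =
  trans (∣∩∣≡∣∩─∣ D M S d) (trans (cong (λ X → ∣ D ∩ X ∣) eq) (sym (∣∩∣≡∣∩─∣ D M S′ d)))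

Disjoint-∪⁻ : ∀ (p q M : Subset n) → Disjoint (p ∪ q) M → Disjoint p M × Disjoint q M
Disjoint-∪⁻ []          []          []          _ = refl , refl
Disjoint-∪⁻ (false ∷ p) (false ∷ q) (_     ∷ M) d = Disjoint-∪⁻ p q M d
Disjoint-∪⁻ (true  ∷ p) (false ∷ q) (false ∷ M) d = Disjoint-∪⁻ p q M d
Disjoint-∪⁻ (false ∷ p) (true  ∷ q) (false ∷ M) d = Disjoint-∪⁻ p q M d
Disjoint-∪⁻ (true  ∷ p) (true  ∷ q) (false ∷ M) d = Disjoint-∪⁻ p q M d
Disjoint-∪⁻ (true  ∷ p) (_     ∷ q) (true  ∷ M) ()
Disjoint-∪⁻ (false ∷ p) (true  ∷ q) (true  ∷ M) ()

Ignores-isATransversal : ∀ A (E : List (Subset n)) {M} → Disjoint (⋃ E) M →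
  Ignores M (isATransversal A E)
Ignores-isATransversal A []      d S S′ eq = refl
Ignores-isATransversal A (H ∷ E) {M} d S S′ eq =
  cong₂ _∧_ (cong A (Ignores-∣∩∣ H (proj₁ d′) S S′ eq))
            (Ignores-isATransversal A E (proj₂ d′) S S′ eq)
  where d′ = Disjoint-∪⁻ H (⋃ E) M d

-- The part of S inside M ranges over all subsets of M, and (∣ M ∣ C b) of them have size b.
sumSubsets-sumOut : ∀ (M : Subset n) (φ : Subset n → ℕ → ℕ) →
  (∀ b → Ignores M (λ S → φ S b)) →
  2 ^ ∣ M ∣ * sumSubsets n (λ S → φ S ∣ M ∩ S ∣) ≡ sumSubsets n (λ S → binomialSum ∣ M ∣ (φ S))
sumSubsets-sumOut []          φ ign = +-identityʳ (φ [] 0)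
sumSubsets-sumOut (false ∷ M) φ ign =
  trans (*-distribˡ-+ (2 ^ ∣ M ∣) _ _)
        (cong₂ _+_ (sumSubsets-sumOut M (φ ∘ (true ∷_)) (Ignores-∷ true false ∘ ign))
                   (sumSubsets-sumOut M (φ ∘ (false ∷_)) (Ignores-∷ false false ∘ ign)))
sumSubsets-sumOut {suc n} (true ∷ M) φ ign = begin
  2 ^ suc q * (sumSubsets n (λ S → φ (true ∷ S) (suc ∣ M ∩ S ∣)) + sumSubsets n (λ S → ψ S ∣ M ∩ S ∣))
    ≡⟨ cong (λ x → 2 ^ suc q * (x + sumSubsets n (λ S → ψ S ∣ M ∩ S ∣)))
            (sumSubsets-cong n (λ S → forget S (suc ∣ M ∩ S ∣))) ⟩
  2 * 2 ^ q * (sumSubsets n (λ S → ψ S (suc ∣ M ∩ S ∣)) + sumSubsets n (λ S → ψ S ∣ M ∩ S ∣))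
    ≡⟨ doubling (2 ^ q) _ _ ⟩
  halves + halves
    ≡⟨ cong (λ x → x + x) (cong₂ _+_ (sumSubsets-sumOut M ψ ignψ)
                                     (sumSubsets-sumOut M (λ S → ψ S ∘ suc) (ignψ ∘ suc))) ⟩
  sums + sums
    ≡⟨ cong (λ x → x + x) (sumSubsets-+ n (λ S → binomialSum q (ψ S)) _) ⟨
  sumSubsets n (λ S → binomialSum (suc q) (ψ S)) + sumSubsets n (λ S → binomialSum (suc q) (ψ S))
    ≡⟨ cong (_+ sumSubsets n (λ S → binomialSum (suc q) (ψ S)))
            (sumSubsets-cong n (λ S → binomialSum-cong (suc q) (λ b → sym (forget S b)))) ⟩
  sumSubsets n (λ S → binomialSum (suc q) (φ (true ∷ S))) + sumSubsets n (λ S → binomialSum (suc q) (ψ S)) ∎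
  where
  open ≡-Reasoning
  q = ∣ M ∣
  ψ : Subset n → ℕ → ℕ
  ψ S = φ (false ∷ S)
  ignψ : ∀ b → Ignores M (λ S → ψ S b)
  ignψ = Ignores-∷ false true ∘ ign
  forget : ∀ S b → φ (true ∷ S) b ≡ ψ S b
  forget S b = ign b (true ∷ S) (false ∷ S) refl
  halves sums : ℕ
  halves = 2 ^ q * sumSubsets n (λ S → ψ S ∣ M ∩ S ∣) + 2 ^ q * sumSubsets n (λ S → ψ S (suc ∣ M ∩ S ∣))
  sums = sumSubsets n (λ S → binomialSum q (ψ S)) + sumSubsets n (λ S → binomialSum q (ψ S ∘ suc))
  doubling : ∀ x a b → 2 * x * (a + b) ≡ (x * b + x * a) + (x * b + x * a)
  doubling = solve-∀

∣∩∣≡∣─∩∣+∣∩∩∣ : ∀ (p q S : Subset n) → ∣ p ∩ S ∣ ≡ ∣ (p ─ q) ∩ S ∣ + ∣ (p ∩ q) ∩ S ∣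
∣∩∣≡∣─∩∣+∣∩∩∣ []          []          []          = refl
∣∩∣≡∣─∩∣+∣∩∩∣ (false ∷ p) (true  ∷ q) (_     ∷ S) = ∣∩∣≡∣─∩∣+∣∩∩∣ p q S
∣∩∣≡∣─∩∣+∣∩∩∣ (false ∷ p) (false ∷ q) (_     ∷ S) = ∣∩∣≡∣─∩∣+∣∩∩∣ p q S
∣∩∣≡∣─∩∣+∣∩∩∣ (true  ∷ p) (true  ∷ q) (true  ∷ S) =
  trans (cong suc (∣∩∣≡∣─∩∣+∣∩∩∣ p q S)) (sym (+-suc _ _))
∣∩∣≡∣─∩∣+∣∩∩∣ (true  ∷ p) (true  ∷ q) (false ∷ S) = ∣∩∣≡∣─∩∣+∣∩∩∣ p q S
∣∩∣≡∣─∩∣+∣∩∩∣ (true  ∷ p) (false ∷ q) (true  ∷ S) = cong suc (∣∩∣≡∣─∩∣+∣∩∩∣ p q S)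
∣∩∣≡∣─∩∣+∣∩∩∣ (true  ∷ p) (false ∷ q) (false ∷ S) = ∣∩∣≡∣─∩∣+∣∩∩∣ p q S

∣─∣+∣∩∣≡∣∣ : ∀ (p q : Subset n) → ∣ p ─ q ∣ + ∣ p ∩ q ∣ ≡ ∣ p ∣
∣─∣+∣∩∣≡∣∣ p q = begin
  ∣ p ─ q ∣ + ∣ p ∩ q ∣
    ≡⟨ cong₂ (λ x y → ∣ x ∣ + ∣ y ∣) (∩-identityʳ (p ─ q)) (∩-identityʳ (p ∩ q)) ⟨
  ∣ (p ─ q) ∩ ⊤ ∣ + ∣ (p ∩ q) ∩ ⊤ ∣ ≡⟨ ∣∩∣≡∣─∩∣+∣∩∩∣ p q ⊤ ⟨
  ∣ p ∩ ⊤ ∣                         ≡⟨ cong ∣_∣ (∩-identityʳ p) ⟩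
  ∣ p ∣                             ∎
  where open ≡-Reasoning

∣∪∣≡∣─∣+∣∣ : ∀ (p q : Subset n) → ∣ p ∪ q ∣ ≡ ∣ p ─ q ∣ + ∣ q ∣
∣∪∣≡∣─∣+∣∣ []          []          = refl
∣∪∣≡∣─∣+∣∣ (true  ∷ p) (true  ∷ q) = trans (cong suc (∣∪∣≡∣─∣+∣∣ p q)) (sym (+-suc _ _))
∣∪∣≡∣─∣+∣∣ (false ∷ p) (true  ∷ q) = trans (cong suc (∣∪∣≡∣─∣+∣∣ p q)) (sym (+-suc _ _))
∣∪∣≡∣─∣+∣∣ (true  ∷ p) (false ∷ q) = cong suc (∣∪∣≡∣─∣+∣∣ p q)
∣∪∣≡∣─∣+∣∣ (false ∷ p) (false ∷ q) = ∣∪∣≡∣─∣+∣∣ p q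

Disjoint-─ : ∀ (p q : Subset n) → Disjoint q (p ─ q)
Disjoint-─ []      []          = refl
Disjoint-─ (_ ∷ p) (true  ∷ q) = Disjoint-─ p q
Disjoint-─ (_ ∷ p) (false ∷ q) = Disjoint-─ p q

Disjoint-∩-─ : ∀ (p q : Subset n) → Disjoint (p ∩ q) (p ─ q)
Disjoint-∩-─ []          []          = refl
Disjoint-∩-─ (true  ∷ p) (true  ∷ q) = Disjoint-∩-─ p q
Disjoint-∩-─ (true  ∷ p) (false ∷ q) = Disjoint-∩-─ p q
Disjoint-∩-─ (false ∷ p) (_     ∷ q) = Disjoint-∩-─ p q

length-filterᵇ-map : ∀ {X Y : Set} (P : Y → Bool) (h : X → Y) xs →
  length (filterᵇ P (map h xs)) ≡ length (filterᵇ (P ∘ h) xs)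
length-filterᵇ-map P h []       = refl
length-filterᵇ-map P h (x ∷ xs) with P (h x)
... | true  = cong suc (length-filterᵇ-map P h xs)
... | false = length-filterᵇ-map P h xs

length-filterᵇ-allSubsets : ∀ n (P : Subset n → Bool) →
  length (filterᵇ P (allSubsets n)) ≡ sumSubsets n (𝟙 ∘ P)
length-filterᵇ-allSubsets zero P with P []
... | true  = refl
... | false = refl
length-filterᵇ-allSubsets (suc n) P =
  trans (cong length (filter-++ (T? ∘ P) (map (true ∷_) (allSubsets n)) _))
  (trans (length-++ (filterᵇ P (map (true ∷_) (allSubsets n))))
         (cong₂ _+_ (trans (length-filterᵇ-map P (true ∷_) (allSubsets n))
                           (length-filterᵇ-allSubsets n (P ∘ (true ∷_))))
                    (trans (length-filterᵇ-map P (false ∷_) (allSubsets n))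
                           (length-filterᵇ-allSubsets n (P ∘ (false ∷_))))))

numTransversals≡sumSubsets : ∀ A (E : List (Subset n)) →
  numTransversals A E ≡ sumSubsets n (λ S → 𝟙 (isATransversal A E S))
numTransversals≡sumSubsets {n} A E = length-filterᵇ-allSubsets n (isATransversal A E)

∈-allSubsets : ∀ (S : Subset n) → S ∈ allSubsets n
∈-allSubsets []          = here refl
∈-allSubsets (true  ∷ S) = ∈-++⁺ˡ (∈-map⁺ (true ∷_) (∈-allSubsets S))
∈-allSubsets (false ∷ S) = ∈-++⁺ʳ (map (true ∷_) (allSubsets _)) (∈-map⁺ (false ∷_) (∈-allSubsets S))

∈-rSubsets⁺ : ∀ {r} {H : Subset n} → ∣ H ∣ ≡ r → H ∈ rSubsets r n
∈-rSubsets⁺ {n} {H = H} ∣H∣≡r =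
  ∈-filter⁺ (T? ∘ λ S → ∣ S ∣ ≡ᵇ _) {xs = allSubsets n} (∈-allSubsets H) (≡⇒≡ᵇ _ _ ∣H∣≡r)

∈-rSubsets⁻ : ∀ {r} {H : Subset n} → H ∈ rSubsets r n → ∣ H ∣ ≡ r
∈-rSubsets⁻ {n} H∈ =
  ≡ᵇ⇒≡ _ _ (proj₂ (∈-filter⁻ (T? ∘ λ S → ∣ S ∣ ≡ᵇ _) {xs = allSubsets n} H∈))

filter-∈-sublists : ∀ {X : Set} {P : X → Set} (P? : ∀ x → Dec (P x)) xs → filter P? xs ∈ sublists xs
filter-∈-sublists P? []       = here refl
filter-∈-sublists P? (x ∷ xs) with does (P? x)
... | true  = ∈-++⁺ˡ (∈-map⁺ (x ∷_) (filter-∈-sublists P? xs))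
... | false = ∈-++⁺ʳ (map (x ∷_) (sublists xs)) (filter-∈-sublists P? xs)

∈-sublists⁻ : ∀ {X : Set} {G xs : List X} {y} → G ∈ sublists xs → y ∈ G → y ∈ xs
∈-sublists⁻ {xs = []}     (here refl) ()
∈-sublists⁻ {xs = x ∷ xs} G∈ y∈G with ∈-++⁻ (map (x ∷_) (sublists xs)) G∈
... | inj₂ G∈′ = there (∈-sublists⁻ G∈′ y∈G)
... | inj₁ G∈map with ∈-map⁻ (x ∷_) G∈map
...   | G′ , G′∈ , refl with y∈G
...     | here refl  = here refl
...     | there y∈G′ = there (∈-sublists⁻ G′∈ y∈G′)

⊆-⋃ : ∀ {H : Subset n} {E} → H ∈ E → H ⊆ ⋃ E
⊆-⋃ {E = _ ∷ E} (here refl)  = p⊆p∪q (⋃ E)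
⊆-⋃ {E = G ∷ E} (there H∈E) = ⊆-trans (⊆-⋃ H∈E) (q⊆p∪q G (⋃ E))

⋃-least : ∀ {E : List (Subset n)} {X} → (∀ {H} → H ∈ E → H ⊆ X) → ⋃ E ⊆ X
⋃-least {E = []}    _   = ⊥⊆
⋃-least {E = H ∷ E} sub = [ sub (here refl) , ⋃-least (sub ∘ there) ]′ ∘ x∈p∪q⁻ H (⋃ E)

noIsolated⇒⋃≡⊤ : ∀ (E : List (Subset n)) → T (noIsolated E) → ⋃ E ≡ ⊤
noIsolated⇒⋃≡⊤ E = full (⋃ E)
  where
  full : ∀ {n} (V : Subset n) → T (and (toList V)) → V ≡ ⊤
  full []          _ = refl
  full (true  ∷ V) h = cong (true ∷_) (full V h)

⋃≡⊤⇒noIsolated : ∀ (E : List (Subset n)) → ⋃ E ≡ ⊤ → T (noIsolated E)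
⋃≡⊤⇒noIsolated {n} E ⋃E≡⊤ = subst (T ∘ and ∘ toList) (sym ⋃E≡⊤) (full n)
  where
  full : ∀ n → T (and (toList (⊤ {n})))
  full zero    = tt
  full (suc n) = full n

≤-foldr-⊔ : ∀ {x xs} → x ∈ xs → x ≤ foldr _⊔_ 0 xs
≤-foldr-⊔ {xs = y ∷ xs} (here refl)  = m≤m⊔n y _
≤-foldr-⊔ {xs = y ∷ xs} (there x∈xs) = ≤-trans (≤-foldr-⊔ x∈xs) (m≤n⊔m y _)

numTransversals≤g : ∀ r A (E : List (Subset n)) → All (λ H → ∣ H ∣ ≡ r) E → ⋃ E ≡ ⊤ →
  numTransversals A E ≤ g r A n
numTransversals≤g {n} r A E sizes ⋃E≡⊤ = begin
  numTransversals A E                 ≡⟨ numTransversals≡sumSubsets A E ⟩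
  sumSubsets n (λ S → 𝟙 (isATransversal A E S))
    ≤⟨ sumSubsets-mono-≤ n (λ S → 𝟙-mono (all-anti-mono (λ H → A ∣ H ∩ S ∣) E′⊆E)) ⟩
  sumSubsets n (λ S → 𝟙 (isATransversal A E′ S)) ≡⟨ numTransversals≡sumSubsets A E′ ⟨
  numTransversals A E′               ≤⟨ ≤-foldr-⊔ (∈-map⁺ (numTransversals A) E′∈) ⟩
  g r A n                            ∎
  where
  open ≤-Reasoning
  open DecMembership (≡-dec {n = n} Bool._≟_) using (_∈?_)
  -- g only ranges over duplicate-free families listed in the order of rSubsets.
  E′ : List (Subset n)
  E′ = filter (_∈? E) (rSubsets r n)
  E′⊆E : ∀ {H} → H ∈ E′ → H ∈ E
  E′⊆E = proj₂ ∘ ∈-filter⁻ (_∈? E) {xs = rSubsets r n}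
  E⊆E′ : ∀ {H} → H ∈ E → H ∈ E′
  E⊆E′ H∈E = ∈-filter⁺ (_∈? E) {xs = rSubsets r n} (∈-rSubsets⁺ (All.lookup sizes H∈E)) H∈E
  ⋃E′≡⊤ : ⋃ E′ ≡ ⊤
  ⋃E′≡⊤ = ⊆-antisym ⊆⊤ (subst (_⊆ ⋃ E′) ⋃E≡⊤ (⋃-least (⊆-⋃ ∘ E⊆E′)))
  E′∈ : E′ ∈ filterᵇ noIsolated (sublists (rSubsets r n))
  E′∈ = ∈-filter⁺ (T? ∘ noIsolated) {xs = sublists (rSubsets r n)}
          (filter-∈-sublists (_∈? E) (rSubsets r n)) (⋃≡⊤⇒noIsolated E′ ⋃E′≡⊤)

g-elim : ∀ r A n (P : ℕ → Set) → (∀ {x y} → P x → P y → P (x ⊔ y)) → P 0 →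
  (∀ (E : List (Subset n)) → All (λ H → ∣ H ∣ ≡ r) E → ⋃ E ≡ ⊤ → P (numTransversals A E)) →
  P (g r A n)
g-elim r A n P P-⊔ P0 P-E = foldr-preservesᵇ {P = P} P-⊔ P0 (map⁺ (All.tabulate bound))
  where
  bound : ∀ {E} → E ∈ filterᵇ noIsolated (sublists (rSubsets r n)) → P (numTransversals A E)
  bound {E} E∈ with ∈-filter⁻ (T? ∘ noIsolated) {xs = sublists (rSubsets r n)} E∈
  ... | E∈sublists , noIso =
    P-E E (All.tabulate (∈-rSubsets⁻ ∘ ∈-sublists⁻ E∈sublists)) (noIsolated⇒⋃≡⊤ E noIso)

argmax : ∀ (h : ℕ → ℕ) m → ∃ λ k → k ≤ m × (∀ j → j ≤ m → h j ≤ h k)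
argmax h zero = 0 , z≤n , λ { .zero z≤n → ≤-refl }
argmax h (suc m) with argmax h m
... | k , k≤m , h≤hk with ≤-total (h k) (h (suc m))
...   | inj₁ hk≤ = suc m , ≤-refl ,
        λ j j≤ → [ (λ j<1+m → ≤-trans (h≤hk j (s≤s⁻¹ j<1+m)) hk≤) , (λ { refl → ≤-refl }) ]′
                   (m≤n⇒m<n∨m≡n j≤)
...   | inj₂ hk≥ = k , m≤n⇒m≤1+n k≤m ,
        λ j j≤ → [ (λ j<1+m → h≤hk j (s≤s⁻¹ j<1+m)) , (λ { refl → hk≥ }) ]′ (m≤n⇒m<n∨m≡n j≤)

0^n≤m : ∀ {n} m → 1 ≤ n → 0 ^ n ≤ m
0^n≤m m (s≤s z≤n) = z≤n

y≤x*y : ∀ {x} y → (0 < y → 0 < x) → y ≤ x * y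
y≤x*y {x} zero      _   = z≤n
y≤x*y {x} y@(suc _) y>0⇒x>0 = m≤n*m y x {{>-nonZero (y>0⇒x>0 z<s)}}

^-split-≤ : ∀ F {e r} x → e ≤ r → 1 ≤ x → F ^ (e + x) ≤ F ^ r * F ^ x
^-split-≤ zero          {e} x _   1≤x = 0^n≤m _ (≤-trans 1≤x (m≤n+m x e))
^-split-≤ F@(suc _) {e} x e≤r _   =
  ≤-trans (≤-reflexive (^-distribˡ-+-* F e x)) (*-monoˡ-≤ (F ^ x) (^-monoʳ-≤ F e≤r))

^-distribʳ-* : ∀ a b p → (a * b) ^ p ≡ a ^ p * b ^ p
^-distribʳ-* a b zero    = refl
^-distribʳ-* a b (suc p) =
  trans (cong (a * b *_) (^-distribʳ-* a b p)) ([m*n]*[o*p]≡[m*o]*[n*p] a b (a ^ p) (b ^ p))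

scaled-^-step : ∀ p {F q u t t′ G B} → 2 ^ q * t ≤ G * t′ → G ^ p ≤ F ^ q →
  (2 ^ u * t′) ^ p ≤ F ^ u * B → (2 ^ (q + u) * t) ^ p ≤ F ^ (q + u) * B
scaled-^-step p {F} {q} {u} {t} {t′} {G} {B} step G^p≤F^q ih = begin
  (2 ^ (q + u) * t) ^ p    ≡⟨ cong (λ x → (x * t) ^ p) (^-distribˡ-+-* 2 q u) ⟩
  (2 ^ q * 2 ^ u * t) ^ p  ≡⟨ cong (_^ p) (swap (2 ^ q) (2 ^ u) t) ⟩
  (2 ^ u * (2 ^ q * t)) ^ p ≤⟨ ^-monoˡ-≤ p (*-monoʳ-≤ (2 ^ u) step) ⟩
  (2 ^ u * (G * t′)) ^ p    ≡⟨ cong (_^ p) (trans (sym (*-assoc (2 ^ u) G t′)) (swap (2 ^ u) G t′)) ⟩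
  (G * (2 ^ u * t′)) ^ p    ≡⟨ ^-distribʳ-* G (2 ^ u * t′) p ⟩
  G ^ p * (2 ^ u * t′) ^ p  ≤⟨ *-mono-≤ G^p≤F^q ih ⟩
  F ^ q * (F ^ u * B)      ≡⟨ *-assoc (F ^ q) (F ^ u) B ⟨
  F ^ q * F ^ u * B        ≡⟨ cong (_* B) (^-distribˡ-+-* F q u) ⟨
  F ^ (q + u) * B          ∎
  where
  open ≤-Reasoning
  swap : ∀ a b c → a * b * c ≡ b * (a * c)
  swap = solve-∀

-- The upper bound

module UpperBound (A : ℕ → Bool) (r p F : ℕ)
  (maximal : (q j : ℕ) → 1 ≤ q → q ≤ r → j + q ≤ r → f q j A ^ p ≤ F ^ q) where

  f^p≤F^q : ∀ q j → q ≤ r → j ≤ r ∸ q → f q j A ^ p ≤ F ^ q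
  f^p≤F^q zero    j _   _  = ≤-trans (^-monoˡ-≤ p (𝟙-mono {b = true} _)) (≤-reflexive (^-zeroˡ p))
  f^p≤F^q (suc q) j q<r j≤ = maximal (suc q) j (s≤s z≤n) q<r (m≤o∸n⇒m+n≤o j q<r j≤)

  edge-extension : ∀ (H : Subset n) E → ∣ H ∣ ≤ r → ∃ λ G → G ^ p ≤ F ^ ∣ H ─ ⋃ E ∣ ×
    2 ^ ∣ H ─ ⋃ E ∣ * numTransversals A (H ∷ E) ≤ G * numTransversals A E
  edge-extension {n} H E ∣H∣≤r = G , f^p≤F^q q (proj₁ best) q≤r (proj₁ (proj₂ best)) , (begin
    2 ^ q * numTransversals A (H ∷ E)
      ≡⟨ cong (2 ^ q *_) (trans (numTransversals≡sumSubsets A (H ∷ E)) (sumSubsets-cong n split)) ⟩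
    2 ^ q * sumSubsets n (λ S → φ S ∣ M ∩ S ∣)
      ≡⟨ sumSubsets-sumOut M φ φ-ignores ⟩
    sumSubsets n (λ S → binomialSum q (φ S))
      ≡⟨ sumSubsets-cong n (λ S → trans (binomialSum-*ʳ q _ (w S))
                                       (cong (_* w S) (sym (f≡binomialSum q ∣ D ∩ S ∣ A)))) ⟩
    sumSubsets n (λ S → f q ∣ D ∩ S ∣ A * w S)
      ≤⟨ sumSubsets-mono-≤ n (λ S → *-monoˡ-≤ (w S) (proj₂ (proj₂ best) _ (d≤ S))) ⟩
    sumSubsets n (λ S → G * w S)
      ≡⟨ sumSubsets-*ˡ n G w ⟩
    G * sumSubsets n w
      ≡⟨ cong (G *_) (numTransversals≡sumSubsets A E) ⟨
    G * numTransversals A E ∎)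
    where
    open ≤-Reasoning
    U M D : Subset n
    U = ⋃ E
    M = H ─ U
    D = H ∩ U
    q : ℕ
    q = ∣ M ∣
    best : ∃ λ k → k ≤ r ∸ q × (∀ j → j ≤ r ∸ q → f q j A ≤ f q k A)
    best = argmax (λ j → f q j A) (r ∸ q)
    G : ℕ
    G = f q (proj₁ best) A
    ∣M∣+∣D∣≤r : q + ∣ D ∣ ≤ r
    ∣M∣+∣D∣≤r = ≤-trans (≤-reflexive (∣─∣+∣∩∣≡∣∣ H U)) ∣H∣≤r
    q≤r : q ≤ r
    q≤r = m+n≤o⇒m≤o q ∣M∣+∣D∣≤r
    d≤ : ∀ S → ∣ D ∩ S ∣ ≤ r ∸ q
    d≤ S = m+n≤o⇒m≤o∸n ∣ D ∩ S ∣
      (≤-trans (+-monoˡ-≤ q (∣p∩q∣≤∣p∣ D S)) (≤-trans (≤-reflexive (+-comm ∣ D ∣ q)) ∣M∣+∣D∣≤r))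
    w : Subset n → ℕ
    w S = 𝟙 (isATransversal A E S)
    φ : Subset n → ℕ → ℕ
    φ S b = 𝟙 (A (b + ∣ D ∩ S ∣)) * w S
    φ-ignores : ∀ b → Ignores M (λ S → φ S b)
    φ-ignores b S S′ eq = cong₂ (λ c t → 𝟙 (A (b + c)) * 𝟙 t)
      (Ignores-∣∩∣ D (Disjoint-∩-─ H U) S S′ eq) (Ignores-isATransversal A E (Disjoint-─ H U) S S′ eq)
    split : ∀ S → 𝟙 (isATransversal A (H ∷ E) S) ≡ φ S ∣ M ∩ S ∣
    split S = trans (𝟙-∧ (A ∣ H ∩ S ∣) _) (cong (λ c → 𝟙 (A c) * w S) (∣∩∣≡∣─∩∣+∣∩∩∣ H U S))

  transversals-bound : ∀ (E : List (Subset n)) → All (λ H → ∣ H ∣ ≤ r) E →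
    (2 ^ ∣ ⋃ E ∣ * numTransversals A E) ^ p ≤ F ^ ∣ ⋃ E ∣ * (2 ^ n) ^ p
  transversals-bound {n} [] [] =
    subst (λ u → (2 ^ u * numTransversals {n} A []) ^ p ≤ F ^ u * (2 ^ n) ^ p) (sym (∣⊥∣≡0 n))
      (≤-reflexive (begin-equality
        (1 * numTransversals {n} A []) ^ p ≡⟨ cong (_^ p) (*-identityˡ _) ⟩
        numTransversals {n} A [] ^ p       ≡⟨ cong (_^ p) (trans (numTransversals≡sumSubsets {n} A [])
                                                                (sumSubsets-1 n)) ⟩
        (2 ^ n) ^ p                        ≡⟨ *-identityˡ _ ⟨
        1 * (2 ^ n) ^ p                    ∎))
    where open ≤-Reasoning
  transversals-bound {n} (H ∷ E) (∣H∣≤r ∷ sizes) with edge-extension H E ∣H∣≤r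
  ... | G , G^p≤ , step =
    subst (λ u → (2 ^ u * numTransversals A (H ∷ E)) ^ p ≤ F ^ u * (2 ^ n) ^ p)
          (sym (∣∪∣≡∣─∣+∣∣ H (⋃ E)))
          (scaled-^-step p {F} {∣ H ─ ⋃ E ∣} {∣ ⋃ E ∣} {numTransversals A (H ∷ E)}
                         {numTransversals A E} {G} {(2 ^ n) ^ p}
                         step G^p≤ (transversals-bound E sizes))

  covering-bound : ∀ (E : List (Subset n)) → All (λ H → ∣ H ∣ ≤ r) E → ⋃ E ≡ ⊤ →
    numTransversals A E ^ p ≤ F ^ n
  covering-bound {n} E sizes ⋃E≡⊤ =
    *-cancelˡ-≤ ((2 ^ n) ^ p) {{m^n≢0 (2 ^ n) p {{m^n≢0 2 n}}}} (begin
      (2 ^ n) ^ p * numTransversals A E ^ p ≡⟨ ^-distribʳ-* (2 ^ n) _ p ⟨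
      (2 ^ n * numTransversals A E) ^ p
        ≤⟨ subst (λ u → (2 ^ u * numTransversals A E) ^ p ≤ F ^ u * (2 ^ n) ^ p)
                 (trans (cong ∣_∣ ⋃E≡⊤) (∣⊤∣≡n n)) (transversals-bound E sizes) ⟩
      F ^ n * (2 ^ n) ^ p                  ≡⟨ *-comm (F ^ n) _ ⟩
      (2 ^ n) ^ p * F ^ n                  ∎)
    where open ≤-Reasoning

  g-upper : 1 ≤ p → ∀ n → g r A n ^ p ≤ F ^ n
  g-upper 1≤p n = g-elim r A n (λ x → x ^ p ≤ F ^ n) ⊔-preserves (0^n≤m (F ^ n) 1≤p)
    (λ E sizes → covering-bound E (All.map ≤-reflexive sizes))
    where
    ⊔-preserves : ∀ {x y} → x ^ p ≤ F ^ n → y ^ p ≤ F ^ n → (x ⊔ y) ^ p ≤ F ^ n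
    ⊔-preserves {x} {y} hx hy = [ (λ e → subst (λ z → z ^ p ≤ F ^ n) (sym e) hx)
                                , (λ e → subst (λ z → z ^ p ≤ F ^ n) (sym e) hy) ]′ (⊔-sel x y)

replicate-+ : ∀ {X : Set} m n (x : X) → replicate (m + n) x ≡ replicate m x ++ replicate n x
replicate-+ zero    n x = refl
replicate-+ (suc m) n x = cong (x ∷_) (replicate-+ m n x)

∣++∣ : ∀ (u : Subset m) (v : Subset n) → ∣ u ++ v ∣ ≡ ∣ u ∣ + ∣ v ∣
∣++∣ []          v = refl
∣++∣ (true  ∷ u) v = cong suc (∣++∣ u v)
∣++∣ (false ∷ u) v = ∣++∣ u v

∣⊥++∣ : ∀ m (v : Subset n) → ∣ ⊥ {m} ++ v ∣ ≡ ∣ v ∣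
∣⊥++∣ m v = trans (∣++∣ (⊥ {m}) v) (cong (_+ ∣ v ∣) (∣⊥∣≡0 m))

∣++∩++∣ : ∀ (u : Subset m) (v : Subset n) s S → ∣ (u ++ v) ∩ (s ++ S) ∣ ≡ ∣ u ∩ s ∣ + ∣ v ∩ S ∣
∣++∩++∣ u v s S = trans (cong ∣_∣ (zipWith-++ _∧_ u v s S)) (∣++∣ (u ∩ s) (v ∩ S))

∣⊥++∩++∣ : ∀ (v : Subset n) (s : Subset m) S → ∣ (⊥ ++ v) ∩ (s ++ S) ∣ ≡ ∣ v ∩ S ∣
∣⊥++∩++∣ {m = m} v s S =
  trans (∣++∩++∣ ⊥ v s S) (cong (_+ ∣ v ∩ S ∣) (trans (cong ∣_∣ (∩-zeroˡ s)) (∣⊥∣≡0 m)))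

∣⊤++∩++∣ : ∀ (v : Subset n) (s : Subset m) S → ∣ (⊤ ++ v) ∩ (s ++ S) ∣ ≡ ∣ s ∣ + ∣ v ∩ S ∣
∣⊤++∩++∣ v s S = trans (∣++∩++∣ ⊤ v s S) (cong (λ x → ∣ x ∣ + ∣ v ∩ S ∣) (∩-identityˡ s))

⊤++-∪-⊥++ : ∀ (u v : Subset n) → (⊤ {m} ++ u) ∪ (⊥ ++ v) ≡ ⊤ ++ (u ∪ v)
⊤++-∪-⊥++ u v = trans (zipWith-++ _∨_ ⊤ u ⊥ v) (cong (_++ (u ∪ v)) (∪-identityʳ ⊤))

⋃-map-⊥++ : ∀ (E : List (Subset n)) → ⋃ (map (⊥ {m} ++_) E) ≡ ⊥ ++ ⋃ E
⋃-map-⊥++ {n} {m} []      = replicate-+ m n false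
⋃-map-⊥++         (H ∷ E) =
  trans (cong ((⊥ ++ H) ∪_) (⋃-map-⊥++ E))
        (trans (zipWith-++ _∨_ ⊥ H ⊥ (⋃ E)) (cong (_++ (H ∪ ⋃ E)) (∪-identityʳ ⊥)))

isATransversal-⊥++ : ∀ A (E : List (Subset n)) (s : Subset m) S →
  isATransversal A (map (⊥ ++_) E) (s ++ S) ≡ isATransversal A E S
isATransversal-⊥++ A []      s S = refl
isATransversal-⊥++ A (H ∷ E) s S =
  cong₂ _∧_ (cong A (∣⊥++∩++∣ H s S)) (isATransversal-⊥++ A E s S)

∣∣≡∣∩∣+∣∁∩∣ : ∀ (q s : Subset n) → ∣ s ∣ ≡ ∣ q ∩ s ∣ + ∣ ∁ q ∩ s ∣
∣∣≡∣∩∣+∣∁∩∣ []          []          = refl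
∣∣≡∣∩∣+∣∁∩∣ (true  ∷ q) (true  ∷ s) = cong suc (∣∣≡∣∩∣+∣∁∩∣ q s)
∣∣≡∣∩∣+∣∁∩∣ (false ∷ q) (true  ∷ s) = trans (cong suc (∣∣≡∣∩∣+∣∁∩∣ q s)) (sym (+-suc _ _))
∣∣≡∣∩∣+∣∁∩∣ (true  ∷ q) (false ∷ s) = ∣∣≡∣∩∣+∣∁∩∣ q s
∣∣≡∣∩∣+∣∁∩∣ (false ∷ q) (false ∷ s) = ∣∣≡∣∩∣+∣∁∩∣ q s

initialSegment : ℕ → Subset n
initialSegment {zero}  _       = []
initialSegment {suc n} zero    = ⊥
initialSegment {suc n} (suc k) = true ∷ initialSegment k

∣initialSegment∣ : ∀ {k} → k ≤ n → ∣ initialSegment {n} k ∣ ≡ k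
∣initialSegment∣ {zero}          z≤n       = refl
∣initialSegment∣ {suc n} {zero}  _         = ∣⊥∣≡0 (suc n)
∣initialSegment∣ {suc n} {suc k} (s≤s k≤n) = cong suc (∣initialSegment∣ k≤n)

-- The lower bound

module Book (A : ℕ → Bool) (p c i : ℕ) where

  vertices : ℕ → ℕ
  vertices zero    = c
  vertices (suc m) = p + vertices m

  core : ∀ m → Subset (vertices m)
  core zero    = ⊤
  core (suc m) = ⊥ ++ core m

  pages : ∀ m → List (Subset (vertices m))
  pages zero    = []
  pages (suc m) = (⊤ ++ core m) ∷ map (⊥ ++_) (pages m)

  coreTransversal : ∀ m → Subset (vertices m) → ℕ
  coreTransversal m S = 𝟙 ((∣ core m ∩ S ∣ ≡ᵇ i) ∧ isATransversal A (pages m) S)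

  coreTransversals-suc : ∀ m → sumSubsets (vertices (suc m)) (coreTransversal (suc m))
                             ≡ f p i A * sumSubsets (vertices m) (coreTransversal m)
  coreTransversals-suc m = begin
    sumSubsets (p + N) (coreTransversal (suc m))
      ≡⟨ sumSubsets-++ p N (coreTransversal (suc m)) ⟩
    sumSubsets N (λ S → sumSubsets p (λ s → coreTransversal (suc m) (s ++ S)))
      ≡⟨ sumSubsets-cong N (λ S → sumSubsets-cong p (λ s → new-page s S)) ⟩
    sumSubsets N (λ S → sumSubsets p (λ s → 𝟙 (A (∣ s ∣ + i)) * coreTransversal m S))
      ≡⟨ sumSubsets-cong N (λ S → trans (sumSubsets-*ʳ p (coreTransversal m S) _)
                                       (cong (_* coreTransversal m S) (sumSubsets-𝟙≡f p i A))) ⟩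
    sumSubsets N (λ S → f p i A * coreTransversal m S)
      ≡⟨ sumSubsets-*ˡ N (f p i A) (coreTransversal m) ⟩
    f p i A * sumSubsets N (coreTransversal m) ∎
    where
    open ≡-Reasoning
    N : ℕ
    N = vertices m
    new-page : ∀ s S → coreTransversal (suc m) (s ++ S) ≡ 𝟙 (A (∣ s ∣ + i)) * coreTransversal m S
    new-page s S = begin
      coreTransversal (suc m) (s ++ S)
        ≡⟨ cong 𝟙 (cong₂ _∧_ (cong (_≡ᵇ i) (∣⊥++∩++∣ (core m) s S))
                             (cong₂ _∧_ (cong A (∣⊤++∩++∣ (core m) s S))
                                        (isATransversal-⊥++ A (pages m) s S))) ⟩
      𝟙 ((∣ core m ∩ S ∣ ≡ᵇ i) ∧ (A (∣ s ∣ + ∣ core m ∩ S ∣) ∧ isATransversal A (pages m) S))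
        ≡⟨ cong 𝟙 (∧-≡ᵇ-subst (λ x → A (∣ s ∣ + x)) ∣ core m ∩ S ∣ i _) ⟩
      𝟙 (A (∣ s ∣ + i) ∧ ((∣ core m ∩ S ∣ ≡ᵇ i) ∧ isATransversal A (pages m) S))
        ≡⟨ 𝟙-∧ (A (∣ s ∣ + i)) _ ⟩
      𝟙 (A (∣ s ∣ + i)) * coreTransversal m S ∎

  F^m≤coreTransversals : i ≤ c → ∀ m → f p i A ^ m ≤ sumSubsets (vertices m) (coreTransversal m)
  F^m≤coreTransversals i≤c zero = begin
    1                                     ≡⟨ T⇒𝟙≡1 (≡⇒≡ᵇ i i refl) ⟨
    𝟙 (i ≡ᵇ i)                            ≤⟨ ≤-binomialSum c (λ b → 𝟙 (b ≡ᵇ i)) i≤c ⟩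
    binomialSum c (λ b → 𝟙 (b ≡ᵇ i))      ≡⟨ sumSubsets-∣∣ c (λ b → 𝟙 (b ≡ᵇ i)) ⟨
    sumSubsets c (λ S → 𝟙 (∣ S ∣ ≡ᵇ i))   ≡⟨ sumSubsets-cong c (λ S → cong 𝟙 (core-only S)) ⟩
    sumSubsets c (coreTransversal zero)  ∎
    where
    open ≤-Reasoning
    core-only : ∀ S → (∣ S ∣ ≡ᵇ i) ≡ ((∣ ⊤ ∩ S ∣ ≡ᵇ i) ∧ true)
    core-only S = trans (cong (λ X → ∣ X ∣ ≡ᵇ i) (sym (∩-identityˡ S))) (sym (Bool.∧-identityʳ _))
  F^m≤coreTransversals i≤c (suc m) =
    ≤-trans (*-monoʳ-≤ (f p i A) (F^m≤coreTransversals i≤c m)) (≤-reflexive (sym (coreTransversals-suc m)))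

  ∣core∣ : ∀ m → ∣ core m ∣ ≡ c
  ∣core∣ zero    = ∣⊤∣≡n c
  ∣core∣ (suc m) = trans (∣⊥++∣ p (core m)) (∣core∣ m)

  ∣pages∣ : ∀ m → All (λ H → ∣ H ∣ ≡ p + c) (pages m)
  ∣pages∣ zero    = []
  ∣pages∣ (suc m) =
    trans (∣++∣ (⊤ {p}) (core m)) (cong₂ _+_ (∣⊤∣≡n p) (∣core∣ m)) ∷
    map⁺ (All.map (λ {H} → trans (∣⊥++∣ p H)) (∣pages∣ m))

  ⋃pages≡⊤ : ∀ m → ⋃ (pages (suc m)) ≡ ⊤
  ⋃pages≡⊤ m = begin
    (⊤ {p} ++ core m) ∪ ⋃ (map (⊥ ++_) (pages m)) ≡⟨ cong ((⊤ ++ core m) ∪_) (⋃-map-⊥++ (pages m)) ⟩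
    (⊤ ++ core m) ∪ (⊥ ++ ⋃ (pages m))        ≡⟨ ⊤++-∪-⊥++ (core m) (⋃ (pages m)) ⟩
    ⊤ ++ (core m ∪ ⋃ (pages m))               ≡⟨ cong (⊤ ++_) (covered m) ⟩
    ⊤ {p} ++ ⊤                                 ≡⟨ replicate-+ p (vertices m) true ⟨
    ⊤                                          ∎
    where
    open ≡-Reasoning
    covered : ∀ m → core m ∪ ⋃ (pages m) ≡ ⊤
    covered zero    = ∪-identityʳ ⊤
    covered (suc m) = trans (cong (core (suc m) ∪_) (⋃pages≡⊤ m)) (∪-zeroʳ (core (suc m)))

  vertices≡ : ∀ m → vertices m ≡ m * p + c
  vertices≡ zero    = refl
  vertices≡ (suc m) = trans (cong (p +_) (vertices≡ m)) (sym (+-assoc p (m * p) c))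

  decompose : .{{NonZero p}} → ∀ n → p + c ≤ n → ∃₂ λ ℓ m → ℓ < p × n ≡ ℓ + vertices (suc m)
  decompose n p+c≤n with (n ∸ c) / p in eq | m≥n⇒m/n>0 {n ∸ c} {p} (m+n≤o⇒m≤o∸n p p+c≤n)
  ... | suc m | _ = ℓ , m , m%n<n (n ∸ c) p , (begin
    n                               ≡⟨ m+[n∸m]≡n (m+n≤o⇒n≤o p p+c≤n) ⟨
    c + (n ∸ c)                     ≡⟨ cong (c +_) (m≡m%n+[m/n]*n (n ∸ c) p) ⟩
    c + (ℓ + (n ∸ c) / p * p)       ≡⟨ cong (λ q → c + (ℓ + q * p)) eq ⟩
    c + (ℓ + suc m * p)             ≡⟨ rearrange c ℓ (suc m * p) ⟩
    ℓ + (suc m * p + c)             ≡⟨ cong (ℓ +_) (vertices≡ (suc m)) ⟨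
    ℓ + vertices (suc m)            ∎)
    where
    open ≡-Reasoning
    ℓ : ℕ
    ℓ = (n ∸ c) % p
    rearrange : ∀ a b d → a + (b + d) ≡ b + (d + a)
    rearrange = solve-∀

  module Closed (ℓ m : ℕ) (ℓ≤p : ℓ ≤ p) where

    hole : Subset p
    hole = initialSegment ℓ

    rest : Subset (vertices (suc m))
    rest = ∁ hole ++ core m

    edges : List (Subset (ℓ + vertices (suc m)))
    edges = (⊤ {ℓ} ++ rest) ∷ map (⊥ {ℓ} ++_) (pages (suc m))

    ∣edges∣ : All (λ H → ∣ H ∣ ≡ p + c) edges
    ∣edges∣ = ∣closing∣ ∷ map⁺ (All.map (λ {H} → trans (∣⊥++∣ ℓ H)) (∣pages∣ (suc m)))
      where
      open ≡-Reasoning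
      ∣closing∣ : ∣ ⊤ {ℓ} ++ rest ∣ ≡ p + c
      ∣closing∣ = begin
        ∣ ⊤ {ℓ} ++ rest ∣               ≡⟨ ∣++∣ (⊤ {ℓ}) rest ⟩
        ∣ ⊤ {ℓ} ∣ + ∣ rest ∣            ≡⟨ cong₂ _+_ (∣⊤∣≡n ℓ) (∣++∣ (∁ hole) (core m)) ⟩
        ℓ + (∣ ∁ hole ∣ + ∣ core m ∣)  ≡⟨ cong₂ (λ x y → ℓ + (x + y))
                                               (trans (∣∁p∣≡n∸∣p∣ hole) (cong (p ∸_) (∣initialSegment∣ ℓ≤p)))
                                               (∣core∣ m) ⟩
        ℓ + (p ∸ ℓ + c)                ≡⟨ +-assoc ℓ (p ∸ ℓ) c ⟨
        ℓ + (p ∸ ℓ) + c                ≡⟨ cong (_+ c) (m+[n∸m]≡n ℓ≤p) ⟩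
        p + c                          ∎

    ⋃edges≡⊤ : ⋃ edges ≡ ⊤
    ⋃edges≡⊤ = begin
      (⊤ {ℓ} ++ rest) ∪ ⋃ (map (⊥ {ℓ} ++_) (pages (suc m)))
        ≡⟨ cong ((⊤ {ℓ} ++ rest) ∪_) (⋃-map-⊥++ {m = ℓ} (pages (suc m))) ⟩
      (⊤ {ℓ} ++ rest) ∪ (⊥ {ℓ} ++ ⋃ (pages (suc m))) ≡⟨ ⊤++-∪-⊥++ {m = ℓ} rest (⋃ (pages (suc m))) ⟩
      ⊤ {ℓ} ++ (rest ∪ ⋃ (pages (suc m)))        ≡⟨ cong (λ X → ⊤ {ℓ} ++ (rest ∪ X)) (⋃pages≡⊤ m) ⟩
      ⊤ {ℓ} ++ (rest ∪ ⊤)                         ≡⟨ cong (⊤ {ℓ} ++_) (∪-zeroʳ rest) ⟩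
      ⊤ {ℓ} ++ ⊤                               ≡⟨ replicate-+ ℓ (vertices (suc m)) true ⟨
      ⊤                                        ∎
      where open ≡-Reasoning

    closing-positive : ∀ S → T (A ∣ (⊤ ++ core m) ∩ S ∣) → 0 < f ℓ ∣ rest ∩ S ∣ A
    closing-positive S A-page with splitAt p S
    ... | s , S′ , refl = begin
      1                                              ≡⟨ T⇒𝟙≡1 (subst (T ∘ A) through-hole A-page) ⟨
      𝟙 (A (∣ hole ∩ s ∣ + ∣ rest ∩ (s ++ S′) ∣))
        ≤⟨ ≤-binomialSum ℓ (λ b → 𝟙 (A (b + ∣ rest ∩ (s ++ S′) ∣)))
                         (≤-trans (∣p∩q∣≤∣p∣ hole s) (≤-reflexive (∣initialSegment∣ ℓ≤p))) ⟩
      binomialSum ℓ (λ b → 𝟙 (A (b + ∣ rest ∩ (s ++ S′) ∣)))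
        ≡⟨ f≡binomialSum ℓ ∣ rest ∩ (s ++ S′) ∣ A ⟨
      f ℓ ∣ rest ∩ (s ++ S′) ∣ A                     ∎
      where
      open ≤-Reasoning
      through-hole : ∣ (⊤ ++ core m) ∩ (s ++ S′) ∣ ≡ ∣ hole ∩ s ∣ + ∣ rest ∩ (s ++ S′) ∣
      through-hole = begin-equality
        ∣ (⊤ ++ core m) ∩ (s ++ S′) ∣                    ≡⟨ ∣⊤++∩++∣ (core m) s S′ ⟩
        ∣ s ∣ + ∣ core m ∩ S′ ∣                          ≡⟨ cong (_+ ∣ core m ∩ S′ ∣) (∣∣≡∣∩∣+∣∁∩∣ hole s) ⟩
        ∣ hole ∩ s ∣ + ∣ ∁ hole ∩ s ∣ + ∣ core m ∩ S′ ∣  ≡⟨ +-assoc ∣ hole ∩ s ∣ _ _ ⟩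
        ∣ hole ∩ s ∣ + (∣ ∁ hole ∩ s ∣ + ∣ core m ∩ S′ ∣)
          ≡⟨ cong (∣ hole ∩ s ∣ +_) (∣++∩++∣ (∁ hole) (core m) s S′) ⟨
        ∣ hole ∩ s ∣ + ∣ rest ∩ (s ++ S′) ∣               ∎

    coreTransversals≤numTransversals : sumSubsets (vertices (suc m)) (coreTransversal (suc m))
                                       ≤ numTransversals A edges
    coreTransversals≤numTransversals = begin
      sumSubsets N (coreTransversal (suc m))
        ≤⟨ sumSubsets-mono-≤ N (λ S → y≤x*y (coreTransversal (suc m) S)
                                             (closing-positive S ∘ first-page S)) ⟩
      sumSubsets N (λ S → f ℓ ∣ rest ∩ S ∣ A * coreTransversal (suc m) S)
        ≤⟨ sumSubsets-mono-≤ N (λ S → *-monoʳ-≤ (f ℓ ∣ rest ∩ S ∣ A)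
                                               (𝟙-mono (T-∧ʳ (∣ core (suc m) ∩ S ∣ ≡ᵇ i)))) ⟩
      sumSubsets N (λ S → f ℓ ∣ rest ∩ S ∣ A * 𝟙 (isATransversal A (pages (suc m)) S))
        ≡⟨ sumSubsets-cong N (λ S → trans (sumSubsets-*ʳ ℓ _ _)
                                         (cong (_* _) (sumSubsets-𝟙≡f ℓ ∣ rest ∩ S ∣ A))) ⟨
      sumSubsets N (λ S → sumSubsets ℓ (λ t → 𝟙 (A (∣ t ∣ + ∣ rest ∩ S ∣))
                                            * 𝟙 (isATransversal A (pages (suc m)) S)))
        ≡⟨ sumSubsets-cong N (λ S → sumSubsets-cong ℓ (λ t → split t S)) ⟨
      sumSubsets N (λ S → sumSubsets ℓ (λ t → 𝟙 (isATransversal A edges (t ++ S))))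
        ≡⟨ sumSubsets-++ ℓ N (λ S → 𝟙 (isATransversal A edges S)) ⟨
      sumSubsets (ℓ + N) (λ S → 𝟙 (isATransversal A edges S))
        ≡⟨ numTransversals≡sumSubsets A edges ⟨
      numTransversals A edges ∎
      where
      open ≤-Reasoning
      N : ℕ
      N = vertices (suc m)
      first-page : ∀ S → 0 < coreTransversal (suc m) S → T (A ∣ (⊤ ++ core m) ∩ S ∣)
      first-page S = T-∧ˡ (A ∣ (⊤ ++ core m) ∩ S ∣) ∘ T-∧ʳ (∣ core (suc m) ∩ S ∣ ≡ᵇ i) ∘ 𝟙>0⇒T
      split : ∀ (t : Subset ℓ) S → 𝟙 (isATransversal A edges (t ++ S))
                                 ≡ 𝟙 (A (∣ t ∣ + ∣ rest ∩ S ∣)) * 𝟙 (isATransversal A (pages (suc m)) S)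
      split t S = trans (cong 𝟙 (cong₂ _∧_ (cong A (∣⊤++∩++∣ rest t S))
                                           (isATransversal-⊥++ A (pages (suc m)) t S)))
                        (𝟙-∧ (A (∣ t ∣ + ∣ rest ∩ S ∣)) _)

    F^[1+m]≤g : i ≤ c → f p i A ^ suc m ≤ g (p + c) A (ℓ + vertices (suc m))
    F^[1+m]≤g i≤c = ≤-trans (F^m≤coreTransversals i≤c (suc m))
      (≤-trans coreTransversals≤numTransversals (numTransversals≤g (p + c) A edges ∣edges∣ ⋃edges≡⊤))

  lower-bound : .{{NonZero p}} → i ≤ c → ∀ n → p + c ≤ n →
    f p i A ^ n ≤ f p i A ^ (p + c) * g (p + c) A n ^ p
  lower-bound i≤c n p+c≤n with decompose n p+c≤n
  ... | ℓ , m , ℓ<p , refl = begin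
    F ^ (ℓ + vertices (suc m))        ≡⟨ cong (F ^_) (trans (cong (ℓ +_) (vertices≡ (suc m)))
                                                            (rearrange ℓ (suc m * p) c)) ⟩
    F ^ (ℓ + c + suc m * p)           ≤⟨ ^-split-≤ F (suc m * p) (+-monoˡ-≤ c (<⇒≤ ℓ<p))
                                                   (≤-trans (>-nonZero⁻¹ p) (m≤m+n p (m * p))) ⟩
    F ^ (p + c) * F ^ (suc m * p)     ≡⟨ cong (F ^ (p + c) *_) (^-*-assoc F (suc m) p) ⟨
    F ^ (p + c) * (F ^ suc m) ^ p     ≤⟨ *-monoʳ-≤ (F ^ (p + c))
                                           (^-monoˡ-≤ p (Closed.F^[1+m]≤g ℓ m (<⇒≤ ℓ<p) i≤c)) ⟩
    F ^ (p + c) * g (p + c) A (ℓ + vertices (suc m)) ^ p ∎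
    where
    open ≤-Reasoning
    F : ℕ
    F = f p i A
    rearrange : ∀ a b d → a + (b + d) ≡ a + d + b
    rearrange = solve-∀

theorem4 : (r : ℕ) → 1 ≤ r → (A : ℕ → Bool) → (∃ λ a → A a ≡ true) →
    (p i : ℕ) → 1 ≤ p → p ≤ r → i + p ≤ r →
    ((q j : ℕ) → 1 ≤ q → q ≤ r → j + q ≤ r → f q j A ^ p ≤ f p i A ^ q) →
    Σ ℕ λ K → Σ ℕ λ N → (n : ℕ) → N ≤ n →
      (f p i A ^ n ≤ K * g r A n ^ p) × (g r A n ^ p ≤ K * f p i A ^ n)
theorem4 r _ A _ p i 1≤p p≤r i+p≤r maximal = suc (F ^ r) , r , λ n r≤n →
    ≤-trans (lower n r≤n) (*-monoˡ-≤ (g r A n ^ p) (n≤1+n (F ^ r))) ,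
    ≤-trans (UpperBound.g-upper A r p F maximal 1≤p n) (m≤n*m (F ^ n) (suc (F ^ r)))
  where
  F c : ℕ
  F = f p i A
  c = r ∸ p
  p+c≡r : p + c ≡ r
  p+c≡r = m+[n∸m]≡n p≤r
  lower : ∀ n → r ≤ n → F ^ n ≤ F ^ r * g r A n ^ p
  lower n r≤n = subst (λ r′ → F ^ n ≤ F ^ r′ * g r′ A n ^ p) p+c≡r
    (Book.lower-bound A p c i {{>-nonZero 1≤p}} (m+n≤o⇒m≤o∸n i i+p≤r) n (subst (_≤ n) (sym p+c≡r) r≤n))
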